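{- Let $n \geq 8$. If $\lambda \vdash 2n$ is a partition all of whose parts are even and $f^\lambda < \binom{2n-4}{4} - \binom{2n-4}{3}$, then $\lambda = (2n)$ or $\lambda = (2n-2,2)$.
   Context: For a partition $\lambda \vdash N$, $f^\lambda$ denotes the dimension of the irreducible complex representation (Specht module) $S^\lambda$ of the symmetric group $S_N$ indexed by $\lambda$, equivalently the number of standard Young tableaux of shape $\lambda$. -}

module Defs where

open import Data.Nat using (ℕ; zero; suc; _≤_; _<_; _≤?_)
open import Data.Nat.Divisibility using (_∣_)
open import Data.List using (List; []; _∷_; map; _++_)
open import Data.Nat.ListAction using (sum)
open import Data.List.Relation.Unary.All using (All)
open import Data.List.Relation.Unary.Linked using (Linked)
open import Data.Product using (_×_)
open import Relation.Binary.PropositionalEquality using (_≡_)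
open import Relation.Nullary using (yes; no)

_⊢_ : List ℕ → ℕ → Set
lam ⊢ N = Linked (λ a b → b ≤ a) lam × All (λ a → 0 < a) lam × sum lam ≡ N

AllPartsEven : List ℕ → Set
AllPartsEven lam = All (λ a → 2 ∣ a) lam

-- Young diagrams obtained from a partition (given as a weakly decreasing
-- list of positive parts) by removing one corner cell.
-- Removing the last cell of row with length a, where `rest` are the rows below.
removeCorner : List ℕ → List (List ℕ)
removeHere : ℕ → List ℕ → List (List ℕ)

removeCorner [] = []
removeCorner (a ∷ rest) = removeHere a rest ++ map (a ∷_) (removeCorner rest)

removeHere zero _ = []
removeHere (suc zero) [] = [] ∷ []
removeHere (suc (suc a)) [] = (suc a ∷ []) ∷ []
removeHere (suc a) (b ∷ rest) with b ≤? a
... | yes _ = (a ∷ b ∷ rest) ∷ []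
... | no  _ = []

-- Number of standard Young tableaux of shape λ with k cells: the cell
-- containing the largest entry k is a corner; removing it leaves a standard
-- Young tableau of the smaller shape.
sytCount : ℕ → List ℕ → ℕ
sytCount zero _ = 1
sytCount (suc k) lam = sum (map (sytCount k) (removeCorner lam))

f : List ℕ → ℕ
f lam = sytCount (sum lam) lam

-- If λ ⊢ N fits inside the (N − s) × (N − s) square and s ≤ 4, then
-- f^λ ≥ C(N − 5, s); this is proved by strong induction on N through the
-- branching rule f^λ = Σ f^μ over the diagrams μ obtained by removing a corner.
-- Every μ fits inside the square for s − 1. If λ is not a rectangle it has at
-- least two corners, and for N ≥ 2s + 4 one of the μ even fits for s, so
-- Pascal's rule C(N − 6, s − 1) + C(N − 6, s) = C(N − 5, s) closes the step;
-- for smaller N the bound 2·C(N − 6, s − 1) is already enough. A rectangle has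
-- a single corner, but the diagram left is not a rectangle, so two steps down
-- give f^λ ≥ 2·C(N − 7, s) ≥ C(N − 5, s) once N ≥ 20; rectangles with at most
-- 19 cells are checked by evaluation.
--
-- An even partition of 2n other than (2n) and (2n − 2, 2) has parts below the
-- first summing to at least 4 and at most n parts, so s = 4 applies, and
-- C(2n − 5, 4) ≥ C(2n − 4, 4) − C(2n − 4, 3).

module Submission where

open import Defs
open import Data.Nat
  using (ℕ; zero; suc; pred; >-nonZero; _+_; _*_; _∸_; _≤_; _<_; _≥_; z≤n; s≤s; _≤?_; _<?_; _≤ᵇ_)
open import Data.Nat.Combinatorics using (_C_; nCk+nC[k+1]≡[n+1]C[k+1])
open import Data.Nat.Divisibility using (_∣_; divides; ∣⇒≤)
open import Data.Bool using (Bool; true; _∧_; if_then_else_)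
open import Data.Bool.Properties using (∧-conicalˡ; ∧-conicalʳ; T-≡)
open import Function.Bundles using (Equivalence)
open import Data.Nat.Properties
open import Data.Nat.Induction using (<-rec)
open import Algebra.Properties.CommutativeSemigroup +-commutativeSemigroup using (interchange)
open import Data.Nat.ListAction using (sum)
open import Data.List using (List; []; _∷_; map; length; replicate)
open import Data.List.Properties using (length-map; length-replicate)
open import Data.List.Relation.Unary.All as All using (All; []; _∷_)
open import Data.List.Relation.Unary.All.Properties using (++⁺; map⁺; replicate⁺)
open import Data.List.Relation.Unary.Any using (here; there)
open import Data.List.Relation.Unary.Linked as Linked using (Linked; []; [-]; _∷_)
open import Data.List.Membership.Propositional using (_∈_)
open import Data.List.Membership.Propositional.Properties using (∈-map⁺; ∈-++⁺ˡ; ∈-++⁺ʳ; ∈-length)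
open import Data.Product using (∃; _×_; _,_; proj₁; proj₂)
open import Data.Sum using (_⊎_; inj₁; inj₂)
open import Relation.Binary.PropositionalEquality
open import Relation.Nullary using (yes; no; contradiction)

m+m≤n+n⇒m≤n : ∀ {m n} → m + m ≤ n + n → m ≤ n
m+m≤n+n⇒m≤n {m} {n} le with m ≤? n
... | yes m≤n = m≤n
... | no  m≰n = contradiction le (<⇒≱ (+-mono-< (≰⇒> m≰n) (≰⇒> m≰n)))

x+x≤2+N⇒x+t≤N : ∀ {x t N} → x + x ≤ 2 + N → t ≤ 4 → 10 ≤ N → x + t ≤ N
x+x≤2+N⇒x+t≤N {x} {t} {N} x+x≤ t≤4 10≤N = m+m≤n+n⇒m≤n (begin
  (x + t) + (x + t) ≡⟨ interchange x t x t ⟩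
  (x + x) + (t + t) ≤⟨ +-mono-≤ x+x≤ (+-mono-≤ t≤4 t≤4) ⟩
  (2 + N) + 8       ≡⟨ +-comm (2 + N) 8 ⟩
  10 + N            ≤⟨ +-monoˡ-≤ N 10≤N ⟩
  N + N             ∎)
  where open ≤-Reasoning

∈⇒≤sum : ∀ {x xs} → x ∈ xs → x ≤ sum xs
∈⇒≤sum {xs = y ∷ ys} (here refl) = m≤m+n y (sum ys)
∈⇒≤sum {xs = y ∷ ys} (there x∈ys) = ≤-trans (∈⇒≤sum x∈ys) (m≤n+m (sum ys) y)

∈⇒+≤sum : ∀ {m x xs} → x ∈ xs → 2 ≤ length xs → All (m ≤_) xs → m + x ≤ sum xs
∈⇒+≤sum {xs = _ ∷ []}     (here refl) (s≤s ()) _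
∈⇒+≤sum {m} {x} {x ∷ z ∷ zs} (here refl) _ (_ ∷ m≤z ∷ _) =
  ≤-trans (≤-reflexive (+-comm m x)) (+-monoʳ-≤ x (≤-trans m≤z (m≤m+n z (sum zs))))
∈⇒+≤sum {xs = y ∷ ys} (there x∈ys) _ (m≤y ∷ _) = +-mono-≤ m≤y (∈⇒≤sum x∈ys)

length≤sum : ∀ {xs} → All (0 <_) xs → length xs ≤ sum xs
length≤sum []       = z≤n
length≤sum (p ∷ ps) = +-mono-≤ p (length≤sum ps)

length+length≤sum : ∀ {xs} → All (2 ≤_) xs → length xs + length xs ≤ sum xs
length+length≤sum []                   = z≤n
length+length≤sum {_ ∷ xs} (p ∷ ps) =
  ≤-trans (≤-reflexive (cong suc (+-suc (length xs) (length xs)))) (+-mono-≤ p (length+length≤sum ps))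

sum-replicate : ∀ r c → sum (replicate r c) ≡ r * c
sum-replicate zero    c = refl
sum-replicate (suc r) c = cong (c +_) (sum-replicate r c)

All≡⇒replicate : ∀ (a : ℕ) {rest} → All (_≡ a) rest → a ∷ rest ≡ replicate (suc (length rest)) a
All≡⇒replicate a []          = refl
All≡⇒replicate a (refl ∷ ps) = cong (a ∷_) (All≡⇒replicate a ps)

allBelow : ℕ → (ℕ → Bool) → Bool
allBelow zero    p = true
allBelow (suc k) p = p k ∧ allBelow k p

allBelow-sound : ∀ k p → allBelow k p ≡ true → ∀ {i} → i < k → p i ≡ true
allBelow-sound (suc k) p all i<1+k with m<1+n⇒m<n∨m≡n i<1+k
... | inj₁ i<k  = allBelow-sound k p (∧-conicalʳ (p k) _ all) i<k
... | inj₂ refl = ∧-conicalˡ (p k) _ all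

≤ᵇ≡true⇒≤ : ∀ {m n} → (m ≤ᵇ n) ≡ true → m ≤ n
≤ᵇ≡true⇒≤ {m} {n} eq = ≤ᵇ⇒≤ m n (Equivalence.from T-≡ eq)

-- Binomial coefficients

pascal-∸5 : ∀ {N} s → 5 ≤ N → (N ∸ 5) C s + (N ∸ 5) C suc s ≡ (suc N ∸ 5) C suc s
pascal-∸5 {N} s 5≤N = trans (nCk+nC[k+1]≡[n+1]C[k+1] (N ∸ 5) s) (cong (_C suc s) (sym (+-∸-assoc 1 5≤N)))

[2+n]Ck≤nCk+nCk : ∀ {n k} → 13 ≤ n → k ≤ 4 → (2 + n) C k ≤ n C k + n C k
[2+n]Ck≤nCk+nCk 13≤n k≤4 with m≤n⇒m<n∨m≡n 13≤n
[2+n]Ck≤nCk+nCk {k = 0} _ _ | inj₂ refl = ≤ᵇ⇒≤ _ _ _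
[2+n]Ck≤nCk+nCk {k = 1} _ _ | inj₂ refl = ≤ᵇ⇒≤ _ _ _
[2+n]Ck≤nCk+nCk {k = 2} _ _ | inj₂ refl = ≤ᵇ⇒≤ _ _ _
[2+n]Ck≤nCk+nCk {k = 3} _ _ | inj₂ refl = ≤ᵇ⇒≤ _ _ _
[2+n]Ck≤nCk+nCk {k = 4} _ _ | inj₂ refl = ≤ᵇ⇒≤ _ _ _
[2+n]Ck≤nCk+nCk {k = suc (suc (suc (suc (suc _))))} _ (s≤s (s≤s (s≤s (s≤s ())))) | inj₂ refl
[2+n]Ck≤nCk+nCk {suc n} {zero}  _ _   | inj₁ _ = s≤s z≤n
[2+n]Ck≤nCk+nCk {suc n} {suc k} _ k<4 | inj₁ 13≤n = begin
    (3 + n) C suc k                     ≡⟨ sym (nCk+nC[k+1]≡[n+1]C[k+1] (2 + n) k) ⟩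
    (2 + n) C k + (2 + n) C suc k       ≤⟨ +-mono-≤ (ih (<⇒≤ k<4)) (ih k<4) ⟩
    (x + x) + (y + y)                   ≡⟨ interchange x x y y ⟩
    (x + y) + (x + y)                   ≡⟨ cong₂ _+_ pascal pascal ⟩
    suc n C suc k + suc n C suc k       ∎
    where
    open ≤-Reasoning
    ih : ∀ {j} → j ≤ 4 → (2 + n) C j ≤ n C j + n C j
    ih = [2+n]Ck≤nCk+nCk (≤-pred 13≤n)
    x y : ℕ
    x = n C k
    y = n C suc k
    pascal : x + y ≡ suc n C suc k
    pascal = nCk+nC[k+1]≡[n+1]C[k+1] n k

[1+n]C[1+k]∸[1+n]Ck≤nC[1+k] : ∀ n k → suc n C suc k ∸ suc n C k ≤ n C suc k
[1+n]C[1+k]∸[1+n]Ck≤nC[1+k] n k = begin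
  suc n C suc k ∸ suc n C k       ≡⟨ cong (_∸ suc n C k) (sym (nCk+nC[k+1]≡[n+1]C[k+1] n k)) ⟩
  (n C k + n C suc k) ∸ suc n C k ≤⟨ ∸-monoʳ-≤ (n C k + n C suc k) (nCk≤[1+n]Ck n k) ⟩
  (n C k + n C suc k) ∸ n C k     ≡⟨ m+n∸m≡n (n C k) (n C suc k) ⟩
  n C suc k                       ∎
  where
  open ≤-Reasoning
  nCk≤[1+n]Ck : ∀ n k → n C k ≤ suc n C k
  nCk≤[1+n]Ck n zero    = ≤-refl
  nCk≤[1+n]Ck n (suc k) = ≤-trans (m≤n+m (n C suc k) (n C k)) (≤-reflexive (nCk+nC[k+1]≡[n+1]C[k+1] n k))

[1+N∸5]C[1+s]≤[N∸5]Cs+[N∸5]Cs : ∀ {N s} → s ≤ 3 → N < suc s + suc s + 3 →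
  (suc N ∸ 5) C suc s ≤ (N ∸ 5) C s + (N ∸ 5) C s
[1+N∸5]C[1+s]≤[N∸5]Cs+[N∸5]Cs s≤3 N<2s+5 =
  ≤ᵇ≡true⇒≤ (allBelow-sound _ _ (allBelow-sound 4 check refl (s≤s s≤3)) N<2s+5)
  where
  check : ℕ → Bool
  check s = allBelow (suc s + suc s + 3) λ N → (suc N ∸ 5) C suc s ≤ᵇ (N ∸ 5) C s + (N ∸ 5) C s

-- Removing a corner

largestPart : List ℕ → ℕ
largestPart []      = 0
largestPart (a ∷ _) = a

-- The split on a is needed: removeHere's case tree inspects a before it
-- reaches the with-abstraction on b ≤? a.
removeHere-∷ : ∀ a b rest →
  b ≤ a × removeHere (suc a) (b ∷ rest) ≡ (a ∷ b ∷ rest) ∷ [] ⊎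
  a < b × removeHere (suc a) (b ∷ rest) ≡ []
removeHere-∷ zero b rest with b ≤? zero
... | yes b≤a = inj₁ (b≤a , refl)
... | no  b≰a = inj₂ (≰⇒> b≰a , refl)
removeHere-∷ (suc a) b rest with b ≤? suc a
... | yes b≤a = inj₁ (b≤a , refl)
... | no  b≰a = inj₂ (≰⇒> b≰a , refl)

removeHere-sum : ∀ a rest → All (λ mu → suc (sum mu) ≡ a + sum rest) (removeHere a rest)
removeHere-sum zero          rest       = []
removeHere-sum (suc zero)    []         = refl ∷ []
removeHere-sum (suc (suc a)) []         = refl ∷ []
removeHere-sum (suc a)       (b ∷ rest) with removeHere-∷ a b rest
... | inj₁ (_ , eq) rewrite eq = refl ∷ []
... | inj₂ (_ , eq) rewrite eq = []

removeHere-largestPart : ∀ a rest → All (λ mu → largestPart mu ≤ a) (removeHere a rest)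
removeHere-largestPart zero          rest       = []
removeHere-largestPart (suc zero)    []         = z≤n ∷ []
removeHere-largestPart (suc (suc a)) []         = n≤1+n _ ∷ []
removeHere-largestPart (suc a)       (b ∷ rest) with removeHere-∷ a b rest
... | inj₁ (_ , eq) rewrite eq = n≤1+n a ∷ []
... | inj₂ (_ , eq) rewrite eq = []

removeHere-length : ∀ a rest → All (λ mu → length mu ≤ length (a ∷ rest)) (removeHere a rest)
removeHere-length zero          rest       = []
removeHere-length (suc zero)    []         = z≤n ∷ []
removeHere-length (suc (suc a)) []         = ≤-refl ∷ []
removeHere-length (suc a)       (b ∷ rest) with removeHere-∷ a b rest
... | inj₁ (_ , eq) rewrite eq = ≤-refl ∷ []
... | inj₂ (_ , eq) rewrite eq = []

removeHere-sorted : ∀ {a rest} → Linked _≥_ (a ∷ rest) → All (Linked _≥_) (removeHere a rest)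
removeHere-sorted {zero}                     _  = []
removeHere-sorted {suc zero}      {[]}       _  = [] ∷ []
removeHere-sorted {suc (suc a)}   {[]}       _  = [-] ∷ []
removeHere-sorted {suc a}         {b ∷ rest} lk with removeHere-∷ a b rest
... | inj₁ (b≤a , eq) rewrite eq = (b≤a ∷ Linked.tail lk) ∷ []
... | inj₂ (_ , eq)   rewrite eq = []

removeHere-positive : ∀ {a rest} → All (0 <_) (a ∷ rest) → All (All (0 <_)) (removeHere a rest)
removeHere-positive {zero}                   _  = []
removeHere-positive {suc zero}    {[]}       _  = [] ∷ []
removeHere-positive {suc (suc a)} {[]}       _  = (s≤s z≤n ∷ []) ∷ []
removeHere-positive {suc a}       {b ∷ rest} (_ ∷ ps) with removeHere-∷ a b rest
... | inj₁ (b≤a , eq) rewrite eq = (≤-trans (All.head ps) b≤a ∷ ps) ∷ []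
... | inj₂ (_ , eq)   rewrite eq = []

removeCorner-sum : ∀ lam → All (λ mu → suc (sum mu) ≡ sum lam) (removeCorner lam)
removeCorner-sum []         = []
removeCorner-sum (a ∷ rest) =
  ++⁺ (removeHere-sum a rest)
      (map⁺ (All.map (λ {mu} e → trans (sym (+-suc a (sum mu))) (cong (a +_) e)) (removeCorner-sum rest)))

removeCorner-largestPart : ∀ lam → All (λ mu → largestPart mu ≤ largestPart lam) (removeCorner lam)
removeCorner-largestPart []         = []
removeCorner-largestPart (a ∷ rest) =
  ++⁺ (removeHere-largestPart a rest) (map⁺ (All.universal (λ _ → ≤-refl) (removeCorner rest)))

removeCorner-length : ∀ lam → All (λ mu → length mu ≤ length lam) (removeCorner lam)
removeCorner-length []         = []
removeCorner-length (a ∷ rest) =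
  ++⁺ (removeHere-length a rest) (map⁺ (All.map s≤s (removeCorner-length rest)))

largestPart-tail : ∀ {a rest} → Linked _≥_ (a ∷ rest) → largestPart rest ≤ a
largestPart-tail [-]     = z≤n
largestPart-tail (p ∷ _) = p

removeCorner-sorted : ∀ {lam} → Linked _≥_ lam → All (Linked _≥_) (removeCorner lam)
removeCorner-sorted {[]}       _  = []
removeCorner-sorted {a ∷ rest} lk =
  ++⁺ (removeHere-sorted lk)
      (map⁺ (All.zipWith prepend (removeCorner-sorted (Linked.tail lk) , removeCorner-largestPart rest)))
  where
  prepend : ∀ {mu} → Linked _≥_ mu × largestPart mu ≤ largestPart rest → Linked _≥_ (a ∷ mu)
  prepend {[]}    _                  = [-]
  prepend {_ ∷ _} (mu-sorted , b≤c) = ≤-trans b≤c (largestPart-tail lk) ∷ mu-sorted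

removeCorner-positive : ∀ {lam} → All (0 <_) lam → All (All (0 <_)) (removeCorner lam)
removeCorner-positive {[]}       _  = []
removeCorner-positive {a ∷ rest} ps@(pa ∷ rest-pos) =
  ++⁺ (removeHere-positive ps) (map⁺ (All.map (pa ∷_) (removeCorner-positive rest-pos)))

removeCorner-⊢ : ∀ {lam N} → lam ⊢ suc N → All (_⊢ N) (removeCorner lam)
removeCorner-⊢ {lam} (sorted , positive , sum≡) =
  All.zipWith (λ ((s , p) , e) → s , p , suc-injective (trans e sum≡))
    (All.zip (removeCorner-sorted sorted , removeCorner-positive positive) , removeCorner-sum lam)

dropLastCell : List ℕ → List ℕ
dropLastCell []              = []
dropLastCell (a ∷ b ∷ rest)  = a ∷ dropLastCell (b ∷ rest)
dropLastCell (suc zero ∷ []) = []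
dropLastCell (a ∷ [])        = pred a ∷ []

dropLastCell-∈ : ∀ {a rest} → All (0 <_) (a ∷ rest) →
  dropLastCell (a ∷ rest) ∈ removeCorner (a ∷ rest)
dropLastCell-∈ {suc zero}    {[]}       _        = here refl
dropLastCell-∈ {suc (suc a)} {[]}       _        = here refl
dropLastCell-∈ {a}           {b ∷ rest} (_ ∷ ps) =
  ∈-++⁺ʳ (removeHere a (b ∷ rest)) (∈-map⁺ (a ∷_) (dropLastCell-∈ ps))

dropLastCell-shortens⊎allParts≥2 : ∀ {a rest} → Linked _≥_ (a ∷ rest) → All (0 <_) (a ∷ rest) →
  suc (length (dropLastCell (a ∷ rest))) ≡ length (a ∷ rest) ⊎ All (2 ≤_) (a ∷ rest)
dropLastCell-shortens⊎allParts≥2 {suc zero}    {[]}    _  _        = inj₁ refl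
dropLastCell-shortens⊎allParts≥2 {suc (suc a)} {[]}    _  _        = inj₂ (s≤s (s≤s z≤n) ∷ [])
dropLastCell-shortens⊎allParts≥2 {a}           {b ∷ r} lk (_ ∷ ps)
  with dropLastCell-shortens⊎allParts≥2 (Linked.tail lk) ps
... | inj₁ shorter      = inj₁ (cong suc shorter)
... | inj₂ (2≤b ∷ 2≤r) = inj₂ (≤-trans 2≤b (Linked.head lk) ∷ 2≤b ∷ 2≤r)

pred∈dropLastCell-replicate : ∀ r {c} → 2 ≤ c → pred c ∈ dropLastCell (replicate (suc r) c)
pred∈dropLastCell-replicate zero    (s≤s (s≤s _)) = here refl
pred∈dropLastCell-replicate (suc r) 2≤c           = there (pred∈dropLastCell-replicate r 2≤c)

rectangle⊎twoCorners : ∀ {a rest} → Linked _≥_ (a ∷ rest) → All (0 <_) (a ∷ rest) →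
  All (_≡ a) rest ⊎ 2 ≤ length (removeCorner (a ∷ rest))
rectangle⊎twoCorners {a}     {[]}    _  _        = inj₁ []
rectangle⊎twoCorners {suc a} {b ∷ r} lk (_ ∷ ps) with removeHere-∷ a b r
... | inj₁ (_ , eq) rewrite eq =
  inj₂ (s≤s (∈-length (∈-map⁺ (suc a ∷_) (dropLastCell-∈ ps))))
... | inj₂ (a<b , eq) rewrite eq with rectangle⊎twoCorners (Linked.tail lk) ps
...   | inj₁ rect = inj₁ (b≡1+a ∷ All.map (λ c≡b → trans c≡b b≡1+a) rect)
  where
  b≡1+a : b ≡ suc a
  b≡1+a = ≤-antisym (Linked.head lk) a<b
...   | inj₂ two  = inj₂ (≤-trans two (≤-reflexive (sym (length-map (suc a ∷_) (removeCorner (b ∷ r))))))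

sytCount-removeCorner : ∀ {N lam mu} → mu ∈ removeCorner lam → sytCount N mu ≤ sytCount (suc N) lam
sytCount-removeCorner mu∈ = ∈⇒≤sum (∈-map⁺ _ mu∈)

sytCount-twoCorners : ∀ {N m k lam mu} → mu ∈ removeCorner lam → k ≤ sytCount N mu →
  2 ≤ length (removeCorner lam) → All (λ nu → m ≤ sytCount N nu) (removeCorner lam) →
  m + k ≤ sytCount (suc N) lam
sytCount-twoCorners {N} {m} {lam = lam} mu∈ k≤ two bounds =
  ≤-trans (+-monoʳ-≤ m k≤) (∈⇒+≤sum (∈-map⁺ _ mu∈) two′ (map⁺ bounds))
  where
  two′ : 2 ≤ length (map (sytCount N) (removeCorner lam))
  two′ = ≤-trans two (≤-reflexive (sym (length-map _ (removeCorner lam))))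

sytCount-positive : ∀ {N lam} → lam ⊢ N → 0 < sytCount N lam
sytCount-positive {zero}             _           = s≤s z≤n
sytCount-positive {suc N} {[]}       (_ , _ , ())
sytCount-positive {suc N} {a ∷ rest} λ⊢          =
  ≤-trans (sytCount-positive (All.lookup (removeCorner-⊢ λ⊢) corner))
          (sytCount-removeCorner {N} {a ∷ rest} corner)
  where
  corner : dropLastCell (a ∷ rest) ∈ removeCorner (a ∷ rest)
  corner = dropLastCell-∈ (proj₁ (proj₂ λ⊢))

-- The bound f^λ ≥ C(N − 5, s)

record Fits (N s : ℕ) (lam : List ℕ) : Set where
  constructor mkFits
  field
    wide : largestPart lam + s ≤ N
    tall : length lam + s ≤ N

Fits-removeCorner : ∀ {N s lam} → Fits N s lam → All (Fits N s) (removeCorner lam)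
Fits-removeCorner {s = s} {lam} (mkFits wide tall) =
  All.zipWith (λ (narrower , shorter) → mkFits (≤-trans (+-monoˡ-≤ s narrower) wide)
                                                (≤-trans (+-monoˡ-≤ s shorter) tall))
              (removeCorner-largestPart lam , removeCorner-length lam)

Fits-pred : ∀ {N s lam} → Fits (suc N) (suc s) lam → Fits N s lam
Fits-pred {s = s} {lam} (mkFits wide tall) = mkFits (shift (largestPart lam) wide) (shift (length lam) tall)
  where
  shift : ∀ {N} x → x + suc s ≤ suc N → x + s ≤ N
  shift x le = ≤-pred (≤-trans (≤-reflexive (sym (+-suc x s))) le)

rectangle-sides : ∀ {N r c s} → sum (replicate r c) ≡ N → Fits N (suc s) (replicate r c) →
  2 ≤ r × 2 ≤ c
rectangle-sides {r = zero}                refl (mkFits () _)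
rectangle-sides {r = suc zero}    {c}     refl (mkFits wide _) =
  contradiction (≤-trans wide (≤-reflexive (+-identityʳ c))) (m+1+n≰m c)
rectangle-sides {N} {suc (suc r)} {zero}  sum≡ (mkFits wide _) =
  contradiction (≤-trans wide (≤-reflexive N≡0)) λ ()
  where
  N≡0 : N ≡ 0
  N≡0 = trans (sym sum≡) (trans (sum-replicate (2 + r) 0) (*-zeroʳ (2 + r)))
rectangle-sides {N} {suc (suc r)} {suc zero} sum≡ (mkFits _ tall) =
  contradiction (≤-trans tall (≤-reflexive N≡ℓ)) (m+1+n≰m _)
  where
  N≡ℓ : N ≡ length (replicate (2 + r) 1)
  N≡ℓ = begin
    N                             ≡⟨ sym sum≡ ⟩
    sum (replicate (2 + r) 1)     ≡⟨ sum-replicate (2 + r) 1 ⟩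
    (2 + r) * 1                   ≡⟨ *-identityʳ (2 + r) ⟩
    2 + r                         ≡⟨ length-replicate (2 + r) ⟨
    length (replicate (2 + r) 1)  ∎
    where open ≡-Reasoning
rectangle-sides {r = suc (suc r)} {suc (suc c)} _ _ = s≤s (s≤s z≤n) , s≤s (s≤s z≤n)

fittingChild-fullRow : ∀ {N s a rest} → (a ∷ rest) ⊢ suc N → a + suc s ≡ suc N → suc s + suc s < N →
  ∃ λ mu → mu ∈ removeCorner (a ∷ rest) × Fits N (suc s) mu
fittingChild-fullRow {s = s} {a} {[]} (_ , _ , sum≡) a+t≡ _ =
  contradiction (+-cancelˡ-≡ a 0 (suc s) (trans sum≡ (sym a+t≡))) λ ()
fittingChild-fullRow {a = zero} (_ , () ∷ _ , _)
fittingChild-fullRow {N} {s} {suc a} {b ∷ r} (_ , positive , sum≡) a+t≡ 2t<N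
  with removeHere-∷ a b r | +-cancelˡ-≡ (suc a) (sum (b ∷ r)) (suc s) (trans sum≡ (sym a+t≡))
... | inj₁ (_ , eq) | rest≡t =
  a ∷ b ∷ r , ∈-++⁺ˡ (subst ((a ∷ b ∷ r) ∈_) (sym eq) (here refl)) , mkFits wide tall
  where
  wide : a + suc s ≤ N
  wide = ≤-reflexive (suc-injective a+t≡)
  tall : suc (length (b ∷ r)) + suc s ≤ N
  tall = ≤-trans (+-monoˡ-≤ (suc s) (s≤s (≤-trans (length≤sum (All.tail positive)) (≤-reflexive rest≡t))))
                 2t<N
... | inj₂ (a<b , _) | rest≡t =
  contradiction (m<n⇒m<1+n 2t<N) (≤⇒≯ (≤-trans (≤-reflexive (sym a+t≡)) (+-monoˡ-≤ (suc s) a≤t)))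
  where
  a≤t : suc a ≤ suc s
  a≤t = ≤-trans a<b (≤-trans (m≤m+n b (sum r)) (≤-reflexive rest≡t))

Fits-dropLastCell : ∀ {N t a rest} → (a ∷ rest) ⊢ suc N → a + t ≤ N →
  length (a ∷ rest) + t ≤ suc N → t + t < N → Fits N t (dropLastCell (a ∷ rest))
Fits-dropLastCell {N} {t} {a} {rest} (sorted , positive , sum≡) wide tall 2t<N with m≤n⇒m<n∨m≡n tall
... | inj₁ (s≤s tall′) = All.lookup (Fits-removeCorner (mkFits wide tall′)) (dropLastCell-∈ positive)
... | inj₂ ℓ+t≡ with dropLastCell-shortens⊎allParts≥2 sorted positive
...   | inj₁ shorter = mkFits narrower (≤-reflexive (suc-injective (trans (cong (_+ t) shorter) ℓ+t≡)))
  where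
  narrower : largestPart (dropLastCell (a ∷ rest)) + t ≤ N
  narrower =
    ≤-trans (+-monoˡ-≤ t (All.lookup (removeCorner-largestPart (a ∷ rest)) (dropLastCell-∈ positive))) wide
...   | inj₂ all≥2 =
  contradiction (m<n⇒m<1+n 2t<N) (≤⇒≯ (≤-trans (≤-reflexive (sym ℓ+t≡)) (+-monoˡ-≤ t ℓ≤t)))
  where
  ℓ : ℕ
  ℓ = length (a ∷ rest)
  ℓ≤t : ℓ ≤ t
  ℓ≤t = +-cancelˡ-≤ ℓ ℓ t (≤-trans (length+length≤sum all≥2) (≤-reflexive (trans sum≡ (sym ℓ+t≡))))

fittingChild : ∀ {N s lam} → lam ⊢ suc N → Fits (suc N) (suc s) lam → suc s + suc s < N →
  ∃ λ mu → mu ∈ removeCorner lam × Fits N (suc s) mu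
fittingChild {lam = []} (_ , _ , ())
fittingChild {lam = a ∷ rest} λ⊢@(_ , positive , _) (mkFits wide tall) 2t<N with m≤n⇒m<n∨m≡n wide
... | inj₂ a+t≡       = fittingChild-fullRow λ⊢ a+t≡ 2t<N
... | inj₁ (s≤s wide′) =
  dropLastCell (a ∷ rest) , dropLastCell-∈ positive , Fits-dropLastCell λ⊢ wide′ tall 2t<N

boundedBy : ℕ → ℕ → Bool
boundedBy n v = allBelow 5 λ s → n C s ≤ᵇ v

rectangleCheck : ℕ → ℕ → Bool
rectangleCheck r c =
  if r * c ≤ᵇ 19 then boundedBy (r * c ∸ 5) (sytCount (r * c) (replicate r c)) else true

-- Checked by evaluation. Normalising `… ≡ true` is much faster than `T …`,
-- and boundedBy receives the count as an argument, so it is computed once.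
smallRectangles : allBelow 18 (λ i → allBelow 18 λ j → rectangleCheck (2 + i) (2 + j)) ≡ true
smallRectangles = refl

rectangle-small : ∀ {r c s} → 2 ≤ r → 2 ≤ c → r * c ≤ 19 → s ≤ 4 →
  (r * c ∸ 5) C s ≤ sytCount (r * c) (replicate r c)
rectangle-small {r@(suc (suc _))} {c@(suc (suc _))} {s} (s≤s (s≤s _)) (s≤s (s≤s _)) rc≤19 s≤4 =
  ≤ᵇ≡true⇒≤ {(r * c ∸ 5) C s} {count}
    (allBelow-sound 5 (λ s → (r * c ∸ 5) C s ≤ᵇ count) bounded (s≤s s≤4))
  where
  count : ℕ
  count = sytCount (r * c) (replicate r c)
  checked : rectangleCheck r c ≡ true
  checked = allBelow-sound 18 (λ j → rectangleCheck r (2 + j))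
              (allBelow-sound 18 (λ i → allBelow 18 λ j → rectangleCheck (2 + i) (2 + j)) smallRectangles
                 (≤-pred (≤-trans (m≤m*n r c) rc≤19)))
              (≤-pred (≤-trans (m≤n*m c r) rc≤19))
  bounded : boundedBy (r * c ∸ 5) count ≡ true
  bounded = subst (λ b → (if b then boundedBy (r * c ∸ 5) count else true) ≡ true)
                  (Equivalence.to T-≡ (≤⇒≤ᵇ rc≤19)) checked

SytBound : ℕ → Set
SytBound N = ∀ {lam s} → lam ⊢ N → s ≤ 4 → Fits N s lam → (N ∸ 5) C s ≤ sytCount N lam

removeCorner-sytBound : ∀ {N lam s} → SytBound N → lam ⊢ suc N → s ≤ 4 → Fits N s lam →
  All (λ mu → (N ∸ 5) C s ≤ sytCount N mu) (removeCorner lam)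
removeCorner-sytBound ih λ⊢ s≤4 fits =
  All.zipWith (λ (mu⊢ , mu-fits) → ih mu⊢ s≤4 mu-fits) (removeCorner-⊢ λ⊢ , Fits-removeCorner fits)

twoCorners-step : ∀ {N a rest s} → SytBound N → (a ∷ rest) ⊢ suc N → s ≤ 3 →
  Fits (suc N) (suc s) (a ∷ rest) → 2 ≤ length (removeCorner (a ∷ rest)) →
  (suc N ∸ 5) C suc s ≤ sytCount (suc N) (a ∷ rest)
twoCorners-step {N} {a} {rest} {s} ih λ⊢@(_ , positive , _) s≤3 fits two with N <? suc s + suc s + 3
... | yes small = begin
  (suc N ∸ 5) C suc s       ≤⟨ [1+N∸5]C[1+s]≤[N∸5]Cs+[N∸5]Cs s≤3 small ⟩
  (N ∸ 5) C s + (N ∸ 5) C s ≤⟨ sytCount-twoCorners {N} {lam = a ∷ rest} last (All.lookup bounds last) two bounds ⟩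
  sytCount (suc N) (a ∷ rest) ∎
  where
  open ≤-Reasoning
  last : dropLastCell (a ∷ rest) ∈ removeCorner (a ∷ rest)
  last = dropLastCell-∈ positive
  bounds : All (λ mu → (N ∸ 5) C s ≤ sytCount N mu) (removeCorner (a ∷ rest))
  bounds = removeCorner-sytBound ih λ⊢ (m≤n⇒m≤1+n s≤3) (Fits-pred fits)
... | no large with fittingChild λ⊢ fits (≤-trans (m<m+n _ (s≤s z≤n)) (≮⇒≥ large))
...   | mu , mu∈ , mu-fits = begin
  (suc N ∸ 5) C suc s           ≡⟨ sym (pascal-∸5 s 5≤N) ⟩
  (N ∸ 5) C s + (N ∸ 5) C suc s ≤⟨ sytCount-twoCorners {N} {lam = a ∷ rest} mu∈ mu-bound two bounds ⟩
  sytCount (suc N) (a ∷ rest)   ∎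
  where
  open ≤-Reasoning
  5≤N : 5 ≤ N
  5≤N = ≤-trans (s≤s (+-monoˡ-≤ 3 (≤-trans (s≤s z≤n) (m≤n+m (suc s) s)))) (≮⇒≥ large)
  mu-bound : (N ∸ 5) C suc s ≤ sytCount N mu
  mu-bound = ih (All.lookup (removeCorner-⊢ λ⊢) mu∈) (s≤s s≤3) mu-fits
  bounds : All (λ mu → (N ∸ 5) C s ≤ sytCount N mu) (removeCorner (a ∷ rest))
  bounds = removeCorner-sytBound ih λ⊢ (m≤n⇒m≤1+n s≤3) (Fits-pred fits)

rectangle-large : ∀ {N r c s} → (∀ {M} → M < N → SytBound M) → 19 < N → replicate r c ⊢ N →
  2 ≤ r → 2 ≤ c → s ≤ 4 → (N ∸ 5) C s ≤ sytCount N (replicate r c)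
rectangle-large {suc (suc n)} {suc (suc r)} {c} {s} ih (s≤s (s≤s 18≤n)) rect⊢@(_ , positive , sum≡)
                (s≤s (s≤s _)) 2≤c@(s≤s (s≤s _)) s≤4 = begin
  (2 + n ∸ 5) C s             ≡⟨ cong (_C s) (+-∸-assoc 2 5≤n) ⟩
  (2 + (n ∸ 5)) C s           ≤⟨ [2+n]Ck≤nCk+nCk (∸-monoˡ-≤ 5 18≤n) s≤4 ⟩
  (n ∸ 5) C s + (n ∸ 5) C s   ≤⟨ sytCount-twoCorners {n} {lam = shorter} last (All.lookup bounds last) two bounds ⟩
  sytCount (suc n) shorter    ≤⟨ sytCount-removeCorner {suc n} {rect} shorter∈ ⟩
  sytCount (2 + n) rect       ∎
  where
  open ≤-Reasoning
  rect shorter : List ℕ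
  rect    = replicate (2 + r) c
  shorter = dropLastCell rect
  5≤n : 5 ≤ n
  5≤n = ≤-trans (≤ᵇ⇒≤ 5 18 _) 18≤n
  10≤n : 10 ≤ n
  10≤n = ≤-trans (≤ᵇ⇒≤ 10 18 _) 18≤n
  shorter∈ : shorter ∈ removeCorner rect
  shorter∈ = dropLastCell-∈ positive
  shorter⊢ : shorter ⊢ suc n
  shorter⊢ = All.lookup (removeCorner-⊢ rect⊢) shorter∈
  last : dropLastCell shorter ∈ removeCorner shorter
  last = dropLastCell-∈ (proj₁ (proj₂ shorter⊢))
  rect-fits : Fits n s rect
  rect-fits = mkFits (x+x≤2+N⇒x+t≤N (≤-trans c+c≤rect (≤-reflexive sum≡)) s≤4 10≤n)
                     (x+x≤2+N⇒x+t≤N (≤-trans r+r≤rect (≤-reflexive sum≡)) s≤4 10≤n)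
    where
    c+c≤rect : c + c ≤ sum rect
    c+c≤rect = +-monoʳ-≤ c (m≤m+n c _)
    r+r≤rect : length rect + length rect ≤ sum rect
    r+r≤rect = length+length≤sum (replicate⁺ (2 + r) 2≤c)
  bounds : All (λ mu → (n ∸ 5) C s ≤ sytCount n mu) (removeCorner shorter)
  bounds = removeCorner-sytBound (ih (m<n⇒m<1+n (n<1+n n))) shorter⊢ s≤4
                                 (All.lookup (Fits-removeCorner rect-fits) shorter∈)
  two : 2 ≤ length (removeCorner shorter)
  two with rectangle⊎twoCorners (proj₁ shorter⊢) (proj₁ (proj₂ shorter⊢))
  ... | inj₂ two′ = two′
  ... | inj₁ all≡c = contradiction (sym (All.lookup all≡c (pred∈dropLastCell-replicate r 2≤c))) 1+n≢n

rectangle-step : ∀ {N lam r c s} → (∀ {M} → M < N → SytBound M) → lam ≡ replicate r c → lam ⊢ N →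
  suc s ≤ 4 → Fits N (suc s) lam → (N ∸ 5) C suc s ≤ sytCount N lam
rectangle-step {N} {r = r} {c} {s} ih refl rect⊢@(_ , _ , sum≡) s<4 rect-fits
  with rectangle-sides sum≡ rect-fits | N ≤? 19
... | 2≤r , 2≤c | yes N≤19 =
  subst (λ M → (M ∸ 5) C suc s ≤ sytCount M (replicate r c)) rc≡N
        (rectangle-small 2≤r 2≤c (≤-trans (≤-reflexive rc≡N) N≤19) s<4)
  where
  rc≡N : r * c ≡ N
  rc≡N = trans (sym (sum-replicate r c)) sum≡
... | 2≤r , 2≤c | no N≰19 = rectangle-large ih (≰⇒> N≰19) rect⊢ 2≤r 2≤c s<4

sytBound : ∀ N → SytBound N
sytBound = <-rec SytBound step
  where
  step : ∀ N → (∀ {M} → M < N → SytBound M) → SytBound N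
  step N       _  {s = zero}                 λ⊢ _ _               = sytCount-positive λ⊢
  step zero    _  {lam}      {suc s}         _  _ (mkFits wide _) =
    contradiction (m+n≤o⇒n≤o (largestPart lam) wide) λ ()
  step (suc N) _  {[]}       {suc s}         (_ , _ , ())
  step (suc N) ih {a ∷ rest} {suc s} λ⊢@(sorted , positive , _) s<4 λ-fits
    with rectangle⊎twoCorners sorted positive
  ... | inj₁ rect = rectangle-step ih (All≡⇒replicate a rect) λ⊢ s<4 λ-fits
  ... | inj₂ two  = twoCorners-step (ih (n<1+n N)) λ⊢ (≤-pred s<4) λ-fits two

-- Even partitions

f≥[N∸4]C4∸[N∸4]C3 : ∀ {N lam} → lam ⊢ N → 5 ≤ N → Fits N 4 lam → (N ∸ 4) C 4 ∸ (N ∸ 4) C 3 ≤ f lam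
f≥[N∸4]C4∸[N∸4]C3 {N} {lam} λ⊢@(_ , _ , sum≡) 5≤N λ-fits = begin
  (N ∸ 4) C 4 ∸ (N ∸ 4) C 3                 ≡⟨ cong (λ m → m C 4 ∸ m C 3) (+-∸-assoc 1 5≤N) ⟩
  suc (N ∸ 5) C 4 ∸ suc (N ∸ 5) C 3         ≤⟨ [1+n]C[1+k]∸[1+n]Ck≤nC[1+k] (N ∸ 5) 3 ⟩
  (N ∸ 5) C 4                               ≤⟨ sytBound N λ⊢ ≤-refl λ-fits ⟩
  sytCount N lam                            ≡⟨ cong (λ M → sytCount M lam) (sym sum≡) ⟩
  f lam                                     ∎
  where open ≤-Reasoning

even⇒≥2 : ∀ {b} → 2 ∣ b → 0 < b → 2 ≤ b
even⇒≥2 even positive = ∣⇒≤ {{>-nonZero positive}} even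

even⇒≡2⊎≥4 : ∀ {b} → 2 ∣ b → 0 < b → b ≡ 2 ⊎ 4 ≤ b
even⇒≡2⊎≥4 (divides 0             refl) ()
even⇒≡2⊎≥4 (divides 1             refl) _ = inj₁ refl
even⇒≡2⊎≥4 (divides (suc (suc _)) refl) _ = inj₂ (s≤s (s≤s (s≤s (s≤s z≤n))))

evenParts⇒[]⊎[2]⊎sum≥4 : ∀ {xs} → All (0 <_) xs → All (2 ∣_) xs →
  xs ≡ [] ⊎ xs ≡ 2 ∷ [] ⊎ 4 ≤ sum xs
evenParts⇒[]⊎[2]⊎sum≥4 [] [] = inj₁ refl
evenParts⇒[]⊎[2]⊎sum≥4 {b ∷ []} (pb ∷ []) (eb ∷ []) with even⇒≡2⊎≥4 eb pb
... | inj₁ refl = inj₂ (inj₁ refl)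
... | inj₂ 4≤b  = inj₂ (inj₂ (≤-trans 4≤b (m≤m+n b 0)))
evenParts⇒[]⊎[2]⊎sum≥4 {b ∷ c ∷ r} (pb ∷ pc ∷ _) (eb ∷ ec ∷ _) =
  inj₂ (inj₂ (+-mono-≤ (even⇒≥2 eb pb) (≤-trans (even⇒≥2 ec pc) (m≤m+n c (sum r)))))

evenParts-Fits : ∀ {n a rest} → (a ∷ rest) ⊢ (2 * n) → AllPartsEven (a ∷ rest) → 4 ≤ sum rest →
  4 ≤ n → Fits (2 * n) 4 (a ∷ rest)
evenParts-Fits {n} {a} {rest} (_ , positive , sum≡) even 4≤rest 4≤n = mkFits wide tall
  where
  ℓ : ℕ
  ℓ = length (a ∷ rest)
  2n≡n+n : 2 * n ≡ n + n
  2n≡n+n = cong (n +_) (+-identityʳ n)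
  wide : a + 4 ≤ 2 * n
  wide = ≤-trans (+-monoʳ-≤ a 4≤rest) (≤-reflexive sum≡)
  ℓ≤n : ℓ ≤ n
  ℓ≤n = m+m≤n+n⇒m≤n (≤-trans (length+length≤sum (All.zipWith (λ (p , e) → even⇒≥2 e p) (positive , even)))
                               (≤-reflexive (trans sum≡ 2n≡n+n)))
  tall : ℓ + 4 ≤ 2 * n
  tall = ≤-trans (+-mono-≤ ℓ≤n 4≤n) (≤-reflexive (sym 2n≡n+n))

lemma3p5 : (n : ℕ) → 8 ≤ n → (lam : List ℕ) → lam ⊢ (2 * n) → AllPartsEven lam →
    f lam < ((2 * n ∸ 4) C 4) ∸ ((2 * n ∸ 4) C 3) →
    (lam ≡ (2 * n) ∷ []) ⊎ (lam ≡ (2 * n ∸ 2) ∷ 2 ∷ [])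
lemma3p5 n 8≤n [] (_ , _ , 0≡2n) _ _ = contradiction (≤-trans 8≤2n (≤-reflexive (sym 0≡2n))) λ ()
  where
  8≤2n : 8 ≤ 2 * n
  8≤2n = ≤-trans 8≤n (m≤m+n n (n + 0))
lemma3p5 n 8≤n (a ∷ rest) λ⊢@(_ , positive , sum≡) even f<
  with evenParts⇒[]⊎[2]⊎sum≥4 (All.tail positive) (All.tail even)
... | inj₁ refl          = inj₁ (cong (_∷ []) (trans (sym (+-identityʳ a)) sum≡))
... | inj₂ (inj₁ refl)   = inj₂ (cong (_∷ 2 ∷ []) (trans (sym (m+n∸n≡m a 2)) (cong (_∸ 2) sum≡)))
... | inj₂ (inj₂ 4≤rest) = contradiction (f≥[N∸4]C4∸[N∸4]C3 λ⊢ 5≤2n λ-fits) (<⇒≱ f<)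
  where
  4≤n : 4 ≤ n
  4≤n = ≤-trans (≤ᵇ⇒≤ 4 8 _) 8≤n
  5≤2n : 5 ≤ 2 * n
  5≤2n = ≤-trans (≤ᵇ⇒≤ 5 8 _) (≤-trans 8≤n (m≤m+n n (n + 0)))
  λ-fits : Fits (2 * n) 4 (a ∷ rest)
  λ-fits = evenParts-Fits λ⊢ even 4≤rest 4≤n
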